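{- For $n\ge 2$, the number of permutations in $S_n$ equivalent to the identity $\iota_n=12\cdots n$ under general $\{\{123,213\}\}$-equivalence is $(n-1)!$.
   Context: Permutations are written as words $\pi_1\cdots\pi_n$. A sequence of distinct integers $a_1a_2a_3$ has pattern $\sigma\in S_3$ if $a_s<a_t\iff\sigma_s<\sigma_t$. A general move on $\pi\in S_n$ chooses any positions $i_1<i_2<i_3$ with $\pi_{i_1}\pi_{i_2}\pi_{i_3}$ of pattern $123$ or $213$ and rearranges these three values in these positions to have the other of these two patterns (i.e., swaps $\pi_{i_1}$ and $\pi_{i_2}$ when both are smaller than $\pi_{i_3}$). Equivalence is the equivalence relation generated by such moves. -}

module Defs where

open import Data.Nat using (ℕ; suc; _<_)
open import Data.Fin using (Fin; toℕ)
import Data.Fin as F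
open import Data.Vec using (Vec; lookup; _[_]≔_; tabulate; toList)
open import Data.List using (List; applyUpTo)
open import Data.Product using (∃; ∃-syntax; _×_)
open import Data.List.Relation.Binary.Permutation.Propositional using (_↭_)
open import Relation.Binary.PropositionalEquality using (_≡_)
open import Relation.Binary.Construct.Closure.Equivalence using (EqClosure)

Word : ℕ → Set
Word n = Vec ℕ n

-- w is (the one-line notation of) a permutation in S_n:
-- its letters are a rearrangement of 1,2,…,n.
IsPerm : ∀ {n} → Word n → Set
IsPerm {n} w = toList w ↭ applyUpTo suc n

ι : (n : ℕ) → Word n
ι n = tabulate (λ i → suc (toℕ i))

swapAt : ∀ {n} → Word n → Fin n → Fin n → Word n
swapAt w i j = (w [ i ]≔ lookup w j) [ j ]≔ lookup w i

-- A general {123,213}-move: positions i₁ < i₂ < i₃ with w_{i₁}, w_{i₂} < w_{i₃}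
-- (i.e. the subsequence has pattern 123 or 213); swap w_{i₁} and w_{i₂}.
Move : ∀ {n} → Word n → Word n → Set
Move {n} w w' =
  ∃[ i₁ ] ∃[ i₂ ] ∃[ i₃ ]
    ((i₁ F.< i₂) × (i₂ F.< i₃)
    × (lookup w i₁ < lookup w i₃) × (lookup w i₂ < lookup w i₃)
    × (w' ≡ swapAt w i₁ i₂))

Equiv : ∀ {n} → Word n → Word n → Set
Equiv = EqClosure Move

-- The {123,213}-equivalence class of the identity ι_{m+1} consists exactly of
-- the words u·(m+1) with u a permutation of 1..m; hence it has m! elements.
--
-- If every letter of u is below c, an adjacent transposition in u
--    is a move on u·c (the letter c plays the role of the "3" of the pattern).
--    Conversely no move touches the last position, since i₁ < i₂ < i₃.
-- 3. The identity.  Hence u·(m+1) is equivalent to ι_{m+1} for every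
--    permutation u of 1..m, and every word equivalent to ι_{m+1} ends in m+1.
--    The class is therefore enumerated by appending m+1 to the arrangements
--    of ι_m, a duplicate-free list of length m!.
module Submission where

open import Defs
open import Data.Nat using (ℕ; _≤_; _∸_)
open import Data.Nat using (_!)
open import Relation.Binary.PropositionalEquality using (_≡_)
open import Data.List using (List; length)
open import Data.List.Membership.Propositional using (_∈_)
open import Data.List.Relation.Unary.Unique.Propositional using (Unique)
open import Data.Product using (∃-syntax; _×_)
open import Function.Bundles using (_⇔_)

open import Data.Nat using (suc; zero; _<_; _*_; _+_; s≤s; z≤n)
import Data.Nat.Properties as NP
open import Data.Fin as F using (Fin; fromℕ)
import Data.Fin.Properties as FP
open import Data.Vec as V using (Vec; []; _∷_; _∷ʳ_; lookup; toList; tabulate; initLast)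
import Data.Vec.Properties as VP
open import Data.List as L using ([]; _∷_; map; concatMap; applyUpTo)
import Data.List.Properties as LP
open import Data.List.Relation.Unary.Any using (here; there)
open import Data.List.Relation.Unary.All as All using (All; []; _∷_)
import Data.List.Relation.Unary.All.Properties as AllP
open import Data.List.Relation.Unary.AllPairs using ([]; _∷_)
import Data.List.Relation.Unary.Unique.Propositional.Properties as UP
import Data.List.Membership.Propositional.Properties as MP
open import Data.List.Membership.Propositional using (_∉_; find; lose)
open import Data.List.Relation.Binary.Permutation.Propositional
  using (_↭_; ↭-refl; ↭-sym; ↭-trans; ↭-prep; ↭-swap)
import Data.List.Relation.Binary.Permutation.Propositional.Properties as PP
open import Data.Product using (_,_; ∃)
open import Data.Empty using (⊥; ⊥-elim)
open import Function.Bundles using (mk⇔; Equivalence)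
open import Relation.Binary.PropositionalEquality
  using (_≢_; refl; sym; trans; cong; cong₂; subst; subst₂; module ≡-Reasoning)
open import Function using (_∘_)
open import Relation.Binary.Construct.Closure.ReflexiveTransitive using (Star; ε; _◅_; _◅◅_)
import Relation.Binary.Construct.Closure.ReflexiveTransitive as Star
open import Relation.Binary.Construct.Closure.Symmetric using (fwd; bwd)

private
  variable
    A : Set
    n k : ℕ

insertions : A → Vec A n → List (Vec A (suc n))
insertions x []      = (x ∷ []) ∷ []
insertions x (y ∷ v) = (x ∷ y ∷ v) ∷ map (y ∷_) (insertions x v)

arrangements : Vec A n → List (Vec A n)
arrangements []      = [] ∷ []
arrangements (x ∷ v) = concatMap (insertions x) (arrangements v)

-- Counting: a word of length n has n+1 insertion points, so the
-- arrangements of an n-letter word number n!.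
length-insertions : (x : A) (v : Vec A n) → length (insertions x v) ≡ suc n
length-insertions x []      = refl
length-insertions x (y ∷ v) =
  cong suc (trans (LP.length-map (y ∷_) (insertions x v)) (length-insertions x v))

length-concatInsertions : (x : A) (us : List (Vec A n)) →
  length (concatMap (insertions x) us) ≡ length us * suc n
length-concatInsertions x []       = refl
length-concatInsertions x (u ∷ us) = trans (LP.length-++ (insertions x u))
  (cong₂ _+_ (length-insertions x u) (length-concatInsertions x us))

length-arrangements : (v : Vec A n) → length (arrangements v) ≡ n !
length-arrangements []                = refl
length-arrangements {n = suc n} (x ∷ v) = begin
  length (concatMap (insertions x) (arrangements v)) ≡⟨ length-concatInsertions x (arrangements v) ⟩
  length (arrangements v) * suc n                   ≡⟨ cong (_* suc n) (length-arrangements v) ⟩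
  n ! * suc n                                       ≡⟨ NP.*-comm (n !) (suc n) ⟩
  suc n !                                           ∎
  where open ≡-Reasoning

insertions-↭ : (x : A) (u : Vec A n) {w : Vec A (suc n)} →
  w ∈ insertions x u → toList w ↭ x ∷ toList u
insertions-↭ x []      (here refl) = ↭-refl
insertions-↭ x (y ∷ u) (here refl) = ↭-refl
insertions-↭ x (y ∷ u) (there w∈) with MP.∈-map⁻ (y ∷_) w∈
... | w′ , w′∈ , refl = ↭-trans (↭-prep y (insertions-↭ x u w′∈)) (↭-swap y x ↭-refl)

arrangements-↭ : (v : Vec A n) {w : Vec A n} → w ∈ arrangements v → toList w ↭ toList v
arrangements-↭ []      (here refl) = ↭-refl
arrangements-↭ (x ∷ v) w∈ with find (MP.∈-concatMap⁻ (insertions x) w∈)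
... | u , u∈ , w∈ins = ↭-trans (insertions-↭ x u w∈ins) (↭-prep x (arrangements-↭ v u∈))

-- Completeness: a word containing x is an insertion of x into the word
-- obtained by deleting one occurrence of x; by induction every
-- rearrangement of v is an arrangement of v.
insertions-head : (x : A) (u : Vec A n) → (x ∷ u) ∈ insertions x u
insertions-head x []      = here refl
insertions-head x (y ∷ u) = here refl

deleteOccurrence : (x : A) (w : Vec A (suc n)) → x ∈ toList w →
  ∃ λ (u : Vec A n) → w ∈ insertions x u × toList w ↭ x ∷ toList u
deleteOccurrence x (a ∷ w) (here refl) = w , insertions-head x w , ↭-refl
deleteOccurrence {n = zero}  x (a ∷ []) (there ())
deleteOccurrence {n = suc n} x (a ∷ w)  (there x∈w) with deleteOccurrence x w x∈w
... | u , w∈ins , w↭ = a ∷ u , there (MP.∈-map⁺ (a ∷_) w∈ins) ,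
                       ↭-trans (↭-prep a w↭) (↭-swap a x ↭-refl)

arrangements-complete : (v w : Vec A n) → toList w ↭ toList v → w ∈ arrangements v
arrangements-complete []      []  _   = here refl
arrangements-complete (x ∷ v) w w↭v
  with deleteOccurrence x w (PP.∈-resp-↭ (↭-sym w↭v) (here refl))
... | u , w∈ins , w↭xu =
  MP.∈-concatMap⁺ (insertions x)
    (lose (arrangements-complete v u (PP.drop-∷ (↭-trans (↭-sym w↭xu) w↭v))) w∈ins)

insertions-unique : (x : A) (u : Vec A n) → x ∉ toList u → Unique (insertions x u)
insertions-unique x []      x∉u = [] ∷ []
insertions-unique x (y ∷ u) x∉u =
  All.tabulate headDistinct
  ∷ UP.map⁺ VP.∷-injectiveʳ (insertions-unique x u (λ x∈u → x∉u (there x∈u)))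
  where
  headDistinct : ∀ {z} → z ∈ map (y ∷_) (insertions x u) → x ∷ y ∷ u ≡ z → ⊥
  headDistinct z∈ eq with MP.∈-map⁻ (y ∷_) z∈
  ... | _ , _ , refl = x∉u (here (VP.∷-injectiveˡ eq))

insertions-injective : (x : A) (u u′ : Vec A n) {w : Vec A (suc n)} →
  x ∉ toList u → x ∉ toList u′ → w ∈ insertions x u → w ∈ insertions x u′ → u ≡ u′
insertions-injective x [] [] _ _ _ _ = refl
insertions-injective x (a ∷ u) (b ∷ u′) _ _ (here e) (here e′) =
  VP.∷-injectiveʳ (trans (sym e) e′)
insertions-injective x (a ∷ u) (b ∷ u′) _ x∉u′ (here e) (there w∈) with MP.∈-map⁻ (b ∷_) w∈
... | _ , _ , e′ = ⊥-elim (x∉u′ (here (VP.∷-injectiveˡ (trans (sym e) e′))))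
insertions-injective x (a ∷ u) (b ∷ u′) x∉u _ (there w∈) (here e) with MP.∈-map⁻ (a ∷_) w∈
... | _ , _ , e′ = ⊥-elim (x∉u (here (VP.∷-injectiveˡ (trans (sym e) e′))))
insertions-injective x (a ∷ u) (b ∷ u′) x∉u x∉u′ (there w∈) (there w∈′)
  with MP.∈-map⁻ (a ∷_) w∈ | MP.∈-map⁻ (b ∷_) w∈′
... | _ , v∈ , e | _ , v∈′ , e′ with VP.∷-injective (trans (sym e) e′)
... | refl , refl = cong (a ∷_)
  (insertions-injective x u u′ (λ x∈ → x∉u (there x∈)) (λ x∈ → x∉u′ (there x∈)) v∈ v∈′)

concatMap-unique : {B : Set} (f : A → List B) (us : List A) → Unique us →
  (∀ {u} → u ∈ us → Unique (f u)) →
  (∀ {u u′ w} → u ∈ us → u′ ∈ us → w ∈ f u → w ∈ f u′ → u ≡ u′) →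
  Unique (concatMap f us)
concatMap-unique f []       _             _       _      = []
concatMap-unique f (u ∷ us) (u∉us ∷ us!) unique≡ disjoint =
  UP.++⁺ (unique≡ (here refl))
    (concatMap-unique f us us! (λ u∈ → unique≡ (there u∈))
      (λ u∈ u′∈ w∈ w∈′ → disjoint (there u∈) (there u′∈) w∈ w∈′))
    λ (w∈fu , w∈rest) → notLater w∈fu w∈rest
  where
  notLater : ∀ {w} → w ∈ f u → w ∈ concatMap f us → ⊥
  notLater w∈fu w∈rest with find (MP.∈-concatMap⁻ f w∈rest)
  ... | u′ , u′∈ , w∈fu′ = All.lookup u∉us u′∈ (disjoint (here refl) (there u′∈) w∈fu w∈fu′)

arrangements-unique : (v : Vec A n) → Unique (toList v) → Unique (arrangements v)
arrangements-unique []      _            = [] ∷ []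
arrangements-unique (x ∷ v) (x∉v ∷ v!) =
  concatMap-unique (insertions x) (arrangements v) (arrangements-unique v v!)
    (λ u∈ → insertions-unique x _ (x∉ u∈))
    (λ u∈ u′∈ → insertions-injective x _ _ (x∉ u∈) (x∉ u′∈))
  where
  x∉ : ∀ {u} → u ∈ arrangements v → x ∉ toList u
  x∉ u∈ x∈u = All.lookup x∉v (PP.∈-resp-↭ (arrangements-↭ v u∈) x∈u) refl

data AdjacentSwap {A : Set} : {n : ℕ} → Vec A n → Vec A n → Set where
  swapFront : (x y : A) (v : Vec A k) → AdjacentSwap (x ∷ y ∷ v) (y ∷ x ∷ v)
  skip      : (a : A) {u u′ : Vec A k} → AdjacentSwap u u′ → AdjacentSwap (a ∷ u) (a ∷ u′)

skipStar : (a : A) {u u′ : Vec A k} →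
  Star AdjacentSwap u u′ → Star AdjacentSwap (a ∷ u) (a ∷ u′)
skipStar a = Star.gmap (a ∷_) (skip a)

insertions-reachable : (x : A) (u : Vec A n) {w : Vec A (suc n)} →
  w ∈ insertions x u → Star AdjacentSwap (x ∷ u) w
insertions-reachable x []      (here refl) = ε
insertions-reachable x (y ∷ u) (here refl) = ε
insertions-reachable x (y ∷ u) (there w∈) with MP.∈-map⁻ (y ∷_) w∈
... | _ , w′∈ , refl = swapFront x y u ◅ skipStar y (insertions-reachable x u w′∈)

arrangements-reachable : (v : Vec A n) {w : Vec A n} →
  w ∈ arrangements v → Star AdjacentSwap v w
arrangements-reachable []      (here refl) = ε
arrangements-reachable (x ∷ v) w∈ with find (MP.∈-concatMap⁻ (insertions x) w∈)
... | u , u∈ , w∈ins = skipStar x (arrangements-reachable v u∈) ◅◅ insertions-reachable x u w∈ins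

rearrangement-reachable : (v w : Vec A n) → toList w ↭ toList v → Star AdjacentSwap v w
rearrangement-reachable v w w↭v = arrangements-reachable v (arrangements-complete v w w↭v)

adjacentSwap-All : {P : A → Set} {u u′ : Vec A n} →
  AdjacentSwap u u′ → All P (toList u) → All P (toList u′)
adjacentSwap-All (swapFront x y v) (px ∷ py ∷ pv) = py ∷ px ∷ pv
adjacentSwap-All (skip a s)        (pa ∷ pu)      = pa ∷ adjacentSwap-All s pu

lookup-∷ʳ-last : (c : A) (v : Vec A k) → lookup (v ∷ʳ c) (fromℕ k) ≡ c
lookup-∷ʳ-last c []      = refl
lookup-∷ʳ-last c (a ∷ v) = lookup-∷ʳ-last c v

move-∷ : (a : ℕ) {w w′ : Word n} → Move w w′ → Move (a ∷ w) (a ∷ w′)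
move-∷ a (i₁ , i₂ , i₃ , i₁<i₂ , i₂<i₃ , w₁<w₃ , w₂<w₃ , refl) =
  F.suc i₁ , F.suc i₂ , F.suc i₃ , s≤s i₁<i₂ , s≤s i₂<i₃ , w₁<w₃ , w₂<w₃ , refl

-- If all letters of u are below c, an adjacent transposition of u is a
-- move on u·c: the two swapped letters and c form a 123 or 213 pattern.
adjacentSwap-move : (c : ℕ) {u u′ : Word k} → AdjacentSwap u u′ →
  All (_< c) (toList u) → Move (u ∷ʳ c) (u′ ∷ʳ c)
adjacentSwap-move c (swapFront {k = k} x y v) (x<c ∷ y<c ∷ _) =
  F.zero , F.suc F.zero , F.suc (F.suc (fromℕ k)) , s≤s z≤n , s≤s (s≤s z≤n) ,
  subst (x <_) (sym (lookup-∷ʳ-last c v)) x<c ,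
  subst (y <_) (sym (lookup-∷ʳ-last c v)) y<c , refl
adjacentSwap-move c (skip a s) (_ ∷ u<c) = move-∷ a (adjacentSwap-move c s u<c)

adjacentSwaps-moves : (c : ℕ) {u u′ : Word k} → Star AdjacentSwap u u′ →
  All (_< c) (toList u) → Star Move (u ∷ʳ c) (u′ ∷ʳ c)
adjacentSwaps-moves c ε        _   = ε
adjacentSwaps-moves c (s ◅ ss) u<c =
  adjacentSwap-move c s u<c ◅ adjacentSwaps-moves c ss (adjacentSwap-All s u<c)

-- A move swaps positions i₁ < i₂ < i₃, so neither is the last position.
move-fixes-last : {w w′ : Word (suc n)} → Move w w′ →
  lookup w (fromℕ n) ≡ lookup w′ (fromℕ n)
move-fixes-last {n} {w} (i₁ , i₂ , i₃ , i₁<i₂ , i₂<i₃ , _ , _ , refl) = sym (begin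
  lookup ((w V.[ i₁ ]≔ lookup w i₂) V.[ i₂ ]≔ lookup w i₁) (fromℕ n)
    ≡⟨ VP.lookup∘update′ (notLast i₂<i₃) (w V.[ i₁ ]≔ lookup w i₂) (lookup w i₁) ⟩
  lookup (w V.[ i₁ ]≔ lookup w i₂) (fromℕ n)
    ≡⟨ VP.lookup∘update′ (notLast i₁<i₂) w (lookup w i₂) ⟩
  lookup w (fromℕ n) ∎)
  where
  open ≡-Reasoning
  notLast : ∀ {i j : Fin (suc n)} → i F.< j → fromℕ n ≢ i
  notLast {j = j} i<j = FP.<⇒≢ (NP.<-≤-trans i<j (FP.≤fromℕ j)) ∘ sym

equiv-fixes-last : {w w′ : Word (suc n)} → Equiv w w′ →
  lookup w (fromℕ n) ≡ lookup w′ (fromℕ n)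
equiv-fixes-last ε                = refl
equiv-fixes-last (fwd mv ◅ steps) = trans (move-fixes-last mv) (equiv-fixes-last steps)
equiv-fixes-last (bwd mv ◅ steps) = trans (sym (move-fixes-last mv)) (equiv-fixes-last steps)

tabulate-∷ʳ : (f : ℕ → A) (m : ℕ) →
  tabulate {n = suc m} (λ i → f (F.toℕ i)) ≡ tabulate {n = m} (λ i → f (F.toℕ i)) ∷ʳ f m
tabulate-∷ʳ f zero    = refl
tabulate-∷ʳ f (suc m) = cong (f 0 ∷_) (tabulate-∷ʳ (λ k → f (suc k)) m)

toList-tabulate : (f : ℕ → A) (m : ℕ) →
  toList (tabulate {n = m} (λ i → f (F.toℕ i))) ≡ applyUpTo f m
toList-tabulate f zero    = refl
toList-tabulate f (suc m) = cong (f 0 ∷_) (toList-tabulate (λ k → f (suc k)) m)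

ι-∷ʳ : (m : ℕ) → ι (suc m) ≡ ι m ∷ʳ suc m
ι-∷ʳ = tabulate-∷ʳ suc

toList-ι : (m : ℕ) → toList (ι m) ≡ applyUpTo suc m
toList-ι = toList-tabulate suc

ι-unique : (m : ℕ) → Unique (toList (ι m))
ι-unique m = subst Unique (sym (toList-ι m))
  (UP.applyUpTo⁺₁ suc m (λ i<j _ si≡sj → NP.<⇒≢ i<j (NP.suc-injective si≡sj)))

ι-bounded : (m : ℕ) → All (_< suc m) (toList (ι m))
ι-bounded m = subst (All (_< suc m)) (sym (toList-ι m)) (AllP.applyUpTo⁺₁ suc m s≤s)

isPerm-↭ι : (m : ℕ) {u : Word m} → IsPerm u → toList u ↭ toList (ι m)
isPerm-↭ι m {u} = subst (toList u ↭_) (sym (toList-ι m))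

arrangements-ι : (m : ℕ) (u : Word m) → u ∈ arrangements (ι m) ⇔ IsPerm u
arrangements-ι m u = mk⇔
  (λ u∈ → subst (toList u ↭_) (toList-ι m) (arrangements-↭ (ι m) u∈))
  (λ u-perm → arrangements-complete (ι m) u (isPerm-↭ι m u-perm))

isPerm-∷ʳ : (m : ℕ) (u : Word m) → IsPerm (u ∷ʳ suc m) ⇔ IsPerm u
isPerm-∷ʳ m u = mk⇔
  (λ perm → ∷ʳ-cancel (subst₂ _↭_ (VP.toList-∷ʳ (suc m) u) (sym (LP.applyUpTo-∷ʳ suc m)) perm))
  (λ perm → subst₂ _↭_ (sym (VP.toList-∷ʳ (suc m) u)) (LP.applyUpTo-∷ʳ suc m)
              (PP.++⁺ʳ L.[ suc m ] perm))
  where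
  ∷ʳ-cancel : ∀ {c : ℕ} {xs ys} → xs L.∷ʳ c ↭ ys L.∷ʳ c → xs ↭ ys
  ∷ʳ-cancel {c} {xs} {ys} p =
    PP.drop-∷ (↭-trans (PP.∷↭∷ʳ c xs) (↭-trans p (↭-sym (PP.∷↭∷ʳ c ys))))

ι-class-last : (m : ℕ) {u : Word m} {c : ℕ} → Equiv (ι (suc m)) (u ∷ʳ c) → c ≡ suc m
ι-class-last m {u} {c} ι≈uc = begin
  c                               ≡⟨ sym (lookup-∷ʳ-last c u) ⟩
  lookup (u ∷ʳ c) (fromℕ m)       ≡⟨ sym (equiv-fixes-last ι≈uc) ⟩
  lookup (ι (suc m)) (fromℕ m)    ≡⟨ cong (λ w → lookup w (fromℕ m)) (ι-∷ʳ m) ⟩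
  lookup (ι m ∷ʳ suc m) (fromℕ m) ≡⟨ lookup-∷ʳ-last (suc m) (ι m) ⟩
  suc m                           ∎
  where open ≡-Reasoning

ι-class-contains : (m : ℕ) (u : Word m) → IsPerm u → Equiv (ι (suc m)) (u ∷ʳ suc m)
ι-class-contains m u u-perm = subst (λ ι′ → Equiv ι′ (u ∷ʳ suc m)) (sym (ι-∷ʳ m))
  (Star.map fwd (adjacentSwaps-moves (suc m)
    (rearrangement-reachable (ι m) u (isPerm-↭ι m u-perm))
    (ι-bounded m)))

proposition2p4 : (n : ℕ) → 2 ≤ n →
    ∃[ L ] (Unique L
    × (∀ (w : Word n) → (w ∈ L) ⇔ (IsPerm w × Equiv (ι n) w))
    × length L ≡ (n ∸ 1) !)
proposition2p4 zero    ()
proposition2p4 (suc m) _ =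
  classList ,
  UP.map⁺ (VP.∷ʳ-injectiveˡ _ _) (arrangements-unique (ι m) (ι-unique m)) ,
  (λ w → mk⇔ (inClass w) (inList w)) ,
  trans (LP.length-map _ (arrangements (ι m))) (length-arrangements (ι m))
  where
  classList : List (Word (suc m))
  classList = map (_∷ʳ suc m) (arrangements (ι m))

  inClass : (w : Word (suc m)) → w ∈ classList → IsPerm w × Equiv (ι (suc m)) w
  inClass w w∈ with MP.∈-map⁻ (_∷ʳ suc m) w∈
  ... | u , u∈ , refl = let u-perm = Equivalence.to (arrangements-ι m u) u∈ in
    Equivalence.from (isPerm-∷ʳ m u) u-perm , ι-class-contains m u u-perm

  inList : (w : Word (suc m)) → IsPerm w × Equiv (ι (suc m)) w → w ∈ classList
  inList w (w-perm , ι≈w) with initLast w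
  ... | u , c , refl with ι-class-last m ι≈w
  ... | refl = MP.∈-map⁺ (_∷ʳ suc m)
    (Equivalence.from (arrangements-ι m u) (Equivalence.to (isPerm-∷ʳ m u) w-perm))
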